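{- $c_{\operatorname{parity}}\leq c_{\min}$.
   Context: For $x\ne y$ in $\omega^\omega$, $\Delta(x,y)=\min\{n:x(n)\ne y(n)\}$. $c_{\operatorname{parity}}:[\omega^\omega]^2\to2$ is $c_{\operatorname{parity}}(x,y)=\Delta(x,y)\bmod2$ and $c_{\min}$ is its restriction to $2^\omega$. For colorings $c$ on $X$ and $d$ on $Y$, $c\le d$ means there is a topological embedding $e:X\to Y$ with $c(x_0,x_1)=d(e(x_0),e(x_1))$ for all $\{x_0,x_1\}\in[X]^2$. -}

module Defs where

open import Data.Nat using (ℕ; _<_)
open import Data.Nat.DivMod using (_%_)
open import Data.Bool using (Bool)
open import Data.Product using (Σ; _×_)
open import Relation.Binary.PropositionalEquality using (_≡_; _≢_)

Baire : Set
Baire = ℕ → ℕ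

Cantor : Set
Cantor = ℕ → Bool

Agree : {A : Set} → (ℕ → A) → (ℕ → A) → ℕ → Set
Agree x y n = ∀ i → i < n → x i ≡ y i

-- Δ(x,y) = n, i.e. n = min {k : x k ≠ y k}  (graph of Δ)
IsΔ : {A : Set} → (ℕ → A) → (ℕ → A) → ℕ → Set
IsΔ x y n = Agree x y n × (x n ≢ y n)

IsCParity : Baire → Baire → ℕ → Set
IsCParity x y k = Σ ℕ (λ n → IsΔ x y n × (n % 2 ≡ k))

IsCMin : Cantor → Cantor → ℕ → Set
IsCMin x y k = Σ ℕ (λ n → IsΔ x y n × (n % 2 ≡ k))

-- continuity w.r.t. the product topologies (ε-δ form)
Continuous : {A B : Set} → ((ℕ → A) → (ℕ → B)) → Set
Continuous e = ∀ x n → Σ ℕ (λ m → ∀ y → Agree x y m → Agree (e x) (e y) n)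

Injective : {A B : Set} → ((ℕ → A) → (ℕ → B)) → Set
Injective e = ∀ x y → (∀ i → e x i ≡ e y i) → ∀ i → x i ≡ y i

-- the inverse e⁻¹ : e[X] → X is continuous
InverseContinuous : {A B : Set} → ((ℕ → A) → (ℕ → B)) → Set
InverseContinuous e = ∀ x n → Σ ℕ (λ m → ∀ y → Agree (e x) (e y) m → Agree x y n)

IsEmbedding : {A B : Set} → ((ℕ → A) → (ℕ → B)) → Set
IsEmbedding e = Continuous e × Injective e × InverseContinuous e

CParity≤CMin : Set
CParity≤CMin = Σ (Baire → Cantor) (λ e → IsEmbedding e ×
  (∀ x y k → IsCParity x y k → IsCMin (e x) (e y) k))

-- Code x ∈ ω^ω as the binary sequence 1^(2x₀) 0 1^(2x₁) 0 1^(2x₂) 0 …, i.e. the unary code of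
-- the doubled sequence.  If Δ(x,y) = n, the codes agree on the first n blocks, whose lengths
-- 2xᵢ+1 are odd, and inside block n they first differ after 2·min(xₙ,yₙ) ones.  Hence the codes
-- first differ at n + (an even number), which has the parity of n.
module Submission where

open import Defs
open import Data.Bool using (true; false)
open import Data.Empty using (⊥-elim)
open import Data.Nat using (ℕ; zero; suc; _+_; _*_; _⊓_; _≤_; s≤s; z<s)
open import Data.Nat.DivMod using (_%_; [m+kn]%n≡m%n)
open import Data.Nat.Properties using (≤-refl; ≤-trans; n≤1+n; m≤m+n; +-assoc; *-distribʳ-+; *-distribʳ-⊓; *-cancelʳ-≡)
open import Data.Nat.Tactic.RingSolver using (solve-∀)
open import Data.Product using (∃; _,_; proj₂)
open import Function using (_∘_)
open import Relation.Binary.PropositionalEquality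

tail : {A : Set} → (ℕ → A) → ℕ → A
tail x i = x (suc i)

module _ {A : Set} {x y : ℕ → A} where

  Agree-≤ : ∀ {m n} → m ≤ n → Agree x y n → Agree x y m
  Agree-≤ m≤n agree i i<m = agree i (≤-trans i<m m≤n)

  Agree-head : ∀ {n} → Agree x y (suc n) → x 0 ≡ y 0
  Agree-head agree = agree 0 z<s

  Agree-tail : ∀ {n} → Agree x y (suc n) → Agree (tail x) (tail y) n
  Agree-tail agree i i<n = agree (suc i) (s≤s i<n)

  Agree-suc : ∀ {n} → x 0 ≡ y 0 → Agree (tail x) (tail y) n → Agree x y (suc n)
  Agree-suc head-eq agree zero    _         = head-eq
  Agree-suc head-eq agree (suc i) (s≤s i<n) = agree i i<n

  IsΔ-suc : ∀ {n} → x 0 ≡ y 0 → IsΔ (tail x) (tail y) n → IsΔ x y (suc n)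
  IsΔ-suc head-eq (agree , differ) = Agree-suc head-eq agree , differ

module _ {A B : Set} (f : A → B) {x y : ℕ → A} {n : ℕ} where

  Agree-map : Agree x y n → Agree (f ∘ x) (f ∘ y) n
  Agree-map agree i i<n = cong f (agree i i<n)

  Agree-map⁻ : (∀ {a b} → f a ≡ f b → a ≡ b) → Agree (f ∘ x) (f ∘ y) n → Agree x y n
  Agree-map⁻ f-injective agree i i<n = f-injective (agree i i<n)

  IsΔ-map : (∀ {a b} → f a ≡ f b → a ≡ b) → IsΔ x y n → IsΔ (f ∘ x) (f ∘ y) n
  IsΔ-map f-injective (agree , differ) = Agree-map agree , differ ∘ f-injective

unary∷ : ℕ → Baire → Cantor
unary∷ zero    x zero    = false
unary∷ zero    x (suc i) = unary∷ (x 0) (tail x) i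
unary∷ (suc k) x zero    = true
unary∷ (suc k) x (suc i) = unary∷ k x i

unary : Baire → Cantor
unary x = unary∷ (x 0) (tail x)

unaryPrefixLength : Baire → ℕ → ℕ
unaryPrefixLength x zero    = 0
unaryPrefixLength x (suc n) = suc (x 0) + unaryPrefixLength (tail x) n

mutual

  unary∷-local : ∀ k i {x y} → Agree x y i → unary∷ k x i ≡ unary∷ k y i
  unary∷-local zero    zero    agree = refl
  unary∷-local zero    (suc i) agree = unary-local i agree
  unary∷-local (suc k) zero    agree = refl
  unary∷-local (suc k) (suc i) agree = unary∷-local k i (Agree-≤ (n≤1+n i) agree)

  unary-local : ∀ i {x y} → Agree x y (suc i) → unary x i ≡ unary y i
  unary-local i {x} {y} agree =
    trans (cong (λ a → unary∷ a (tail x) i) (Agree-head agree)) (unary∷-local (y 0) i (Agree-tail agree))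

unary∷-IsΔ-distinct : ∀ a b {x y} → a ≢ b → IsΔ (unary∷ a x) (unary∷ b y) (a ⊓ b)
unary∷-IsΔ-distinct zero    zero    a≢b = ⊥-elim (a≢b refl)
unary∷-IsΔ-distinct zero    (suc b) a≢b = (λ _ ()) , λ ()
unary∷-IsΔ-distinct (suc a) zero    a≢b = (λ _ ()) , λ ()
unary∷-IsΔ-distinct (suc a) (suc b) a≢b = IsΔ-suc refl (unary∷-IsΔ-distinct a b (a≢b ∘ cong suc))

unary∷-IsΔ-shift : ∀ a {m x y} → IsΔ (unary x) (unary y) m → IsΔ (unary∷ a x) (unary∷ a y) (suc a + m)
unary∷-IsΔ-shift zero    differ = IsΔ-suc refl differ
unary∷-IsΔ-shift (suc a) differ = IsΔ-suc refl (unary∷-IsΔ-shift a differ)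

unary-IsΔ : ∀ n {x y} → IsΔ x y n →
  IsΔ (unary x) (unary y) (unaryPrefixLength x n + x n ⊓ y n)
unary-IsΔ zero    {x} {y} (_ , x₀≢y₀) = unary∷-IsΔ-distinct (x 0) (y 0) x₀≢y₀
unary-IsΔ (suc n) {x} {y} (agree , differ) =
  subst₂ (λ b p → IsΔ (unary x) (unary∷ b (tail y)) p)
    (Agree-head agree) (sym (+-assoc (suc (x 0)) _ _))
    (unary∷-IsΔ-shift (x 0) (unary-IsΔ n (Agree-tail agree , differ)))

unary∷-Agree-head : ∀ a b {x y} → Agree (unary∷ a x) (unary∷ b y) (suc a) → a ≡ b
unary∷-Agree-head zero    zero    agree = refl
unary∷-Agree-head zero    (suc b) agree with () ← agree 0 z<s
unary∷-Agree-head (suc a) zero    agree with () ← agree 0 z<s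
unary∷-Agree-head (suc a) (suc b) agree = cong suc (unary∷-Agree-head a b (Agree-tail agree))

unary∷-Agree-shift : ∀ a {m x y} → Agree (unary∷ a x) (unary∷ a y) (suc a + m) → Agree (unary x) (unary y) m
unary∷-Agree-shift zero    agree = Agree-tail agree
unary∷-Agree-shift (suc a) agree = unary∷-Agree-shift a (Agree-tail agree)

unary-Agree : ∀ n {x y} → Agree (unary x) (unary y) (unaryPrefixLength x n) → Agree x y n
unary-Agree zero    agree = λ _ ()
unary-Agree (suc n) {x} {y} agree =
  Agree-suc x₀≡y₀ (unary-Agree n (unary∷-Agree-shift (x 0) agree′))
  where
  x₀≡y₀ : x 0 ≡ y 0
  x₀≡y₀ = unary∷-Agree-head (x 0) (y 0) (Agree-≤ (m≤m+n (suc (x 0)) _) agree)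
  agree′ : Agree (unary x) (unary∷ (x 0) (tail y)) (unaryPrefixLength x (suc n))
  agree′ = subst (λ b → Agree (unary x) (unary∷ b (tail y)) _) (sym x₀≡y₀) agree

double : Baire → Baire
double x = (_* 2) ∘ x

*2-injective : ∀ {a b} → a * 2 ≡ b * 2 → a ≡ b
*2-injective {a} {b} = *-cancelʳ-≡ a b 2

unaryPrefixLength-double : ∀ x n → ∃ λ s → unaryPrefixLength (double x) n ≡ n + s * 2
unaryPrefixLength-double x zero    = 0 , refl
unaryPrefixLength-double x (suc n) with unaryPrefixLength-double (tail x) n
... | s , eq = x 0 + s , trans (cong (suc (x 0 * 2) +_) eq) (rearrange (x 0) n s)
  where
  rearrange : ∀ a n s → suc (a * 2 + (n + s * 2)) ≡ suc n + (a + s) * 2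
  rearrange = solve-∀

unary-double-IsΔ-parity : ∀ x y n →
  (unaryPrefixLength (double x) n + double x n ⊓ double y n) % 2 ≡ n % 2
unary-double-IsΔ-parity x y n with unaryPrefixLength-double x n
... | s , eq = begin
  (unaryPrefixLength (double x) n + (x n * 2) ⊓ (y n * 2)) % 2
    ≡⟨ cong₂ (λ l m → (l + m) % 2) eq (sym (*-distribʳ-⊓ 2 (x n) (y n))) ⟩
  (n + s * 2 + (x n ⊓ y n) * 2) % 2
    ≡⟨ cong (_% 2) (+-assoc n _ _) ⟩
  (n + (s * 2 + (x n ⊓ y n) * 2)) % 2
    ≡⟨ cong (λ m → (n + m) % 2) (sym (*-distribʳ-+ 2 s (x n ⊓ y n))) ⟩
  (n + (s + x n ⊓ y n) * 2) % 2
    ≡⟨ [m+kn]%n≡m%n n (s + x n ⊓ y n) 2 ⟩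
  n % 2
    ∎
  where open ≡-Reasoning

embed : Baire → Cantor
embed = unary ∘ double

embed-continuous : Continuous embed
embed-continuous x n = n , λ y agree i i<n → unary-local i (Agree-map (_* 2) (Agree-≤ i<n agree))

embed-inverseContinuous : InverseContinuous embed
embed-inverseContinuous x n =
  unaryPrefixLength (double x) n , λ y agree → Agree-map⁻ (_* 2) *2-injective (unary-Agree n agree)

embed-injective : Injective embed
embed-injective x y eq i = proj₂ (embed-inverseContinuous x (suc i)) y (λ j _ → eq j) i ≤-refl

embed-preserves-colour : ∀ x y k → IsCParity x y k → IsCMin (embed x) (embed y) k
embed-preserves-colour x y k (n , differ , n%2≡k) =
  _ , unary-IsΔ n (IsΔ-map (_* 2) *2-injective differ) , trans (unary-double-IsΔ-parity x y n) n%2≡k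

mainTheorem9 : CParity≤CMin
mainTheorem9 =
  embed , (embed-continuous , embed-injective , embed-inverseContinuous) , embed-preserves-colour
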